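{- Let $\mathbf{A}$, $\succ$ and $\mathbf{A}_r$ ($r>0$ real) be as in the context. For every $r>0$ there exists a good sequence in $\mathbf{A}_r$, and every good sequence $\{(a_n,b_n)\}_{n\geq1}$ in $\mathbf{A}_r$ is cofinal in $\mathbf{A}_r$ with respect to $\succ$, i.e. for every $(a,b)\in\mathbf{A}_r$ there is $n$ with $(a,b)\succ(a_n,b_n)$.
   Context: $\mathbf{A}=\{(a,b)\mid a,b\in\mathbb{Z}_{\geq1}\}$. Write $(a,b)\succ\succ(a',b')$ if $(a',b')$ is one of $(a+1,b)$, $(a,b-1)$, $(na,nb)$ ($n\in\mathbb{Z}_{\geq1}$), and $(a,b)\succ(a',b')$ if there is a finite chain $(a,b)=(a_0,b_0)\succ\succ\cdots\succ\succ(a_n,b_n)=(a',b')$, $n\ge 0$. For $r>0$, $\mathbf{A}_r=\{(a,b)\in\mathbf{A}\mid b/a>r\}$. A sequence $\{(a_n,b_n)\}_{n\geq1}$ of elements of $\mathbf{A}_r$ is a good sequence if (i) $(a_1,b_1)\succ(a_2,b_2)\succ\cdots$, $b_n/a_n>r$ for all $n$ and $\lim_n b_n/a_n=r$; (ii) $a_n$ divides $a_{n+1}$ for all $n$, and for every $m\in\mathbb{Z}_{\geq1}$ there is $n$ with $m\mid a_n$. -}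

module Defs where

open import Data.Nat as ℕ using (ℕ; zero; suc; _*_; _≥_; _≤_)
open import Data.Nat.Divisibility using (_∣_)
open import Data.Integer using (+_)
open import Data.Rational as ℚ using (ℚ; 0ℚ; _/_; _-_)
open import Data.Product using (_×_; _,_; proj₁; Σ; ∃; ∃-syntax)
open import Data.Sum using (_⊎_)
open import Relation.Nullary using (¬_)
open import Relation.Binary.Construct.Closure.ReflexiveTransitive using (Star)

-- Positive real numbers as (two-sided, located) Dedekind cuts on ℚ.
-- "Lower q" means q < r, "Upper q" means r < q.
record PosReal : Set₁ where
  field
    Lower Upper   : ℚ → Set
    lower-inhab   : ∃ Lower
    upper-inhab   : ∃ Upper
    lower-round₁  : ∀ {q} → Lower q → ∃[ q' ] (q ℚ.< q' × Lower q')
    lower-round₂  : ∀ {q q'} → q ℚ.< q' → Lower q' → Lower q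
    upper-round₁  : ∀ {q} → Upper q → ∃[ q' ] (q' ℚ.< q × Upper q')
    upper-round₂  : ∀ {q q'} → q' ℚ.< q → Upper q' → Upper q
    disjoint      : ∀ {q} → ¬ (Lower q × Upper q)
    located       : ∀ {q q'} → q ℚ.< q' → Lower q ⊎ Upper q'
    positive      : Lower 0ℚ

open PosReal public

Pair : Set
Pair = ℕ × ℕ

InA : Pair → Set
InA (a , b) = (a ≥ 1) × (b ≥ 1)

-- the rational b / a (only used for a ≥ 1; the a = 0 clause is a dummy)
ratio : Pair → ℚ
ratio (zero  , b) = 0ℚ
ratio (suc a , b) = + b / suc a

data _≻≻_ : Pair → Pair → Set where
  incA : ∀ {a b} → (a , b) ≻≻ (suc a , b)
  decB : ∀ {a b} → (a , suc (suc b)) ≻≻ (a , suc b)   -- (a,b) ≻≻ (a,b-1), staying in A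
  mulN : ∀ {a b} (n : ℕ) → n ≥ 1 → (a , b) ≻≻ (n * a , n * b)

_≻_ : Pair → Pair → Set
_≻_ = Star _≻≻_

InAr : PosReal → Pair → Set
InAr r p = InA p × Upper r (ratio p)

-- good sequences; the paper's index n ≥ 1 corresponds to s (n - 1) here
record GoodSeq (r : PosReal) (s : ℕ → Pair) : Set where
  field
    inAr    : ∀ n → InAr r (s n)
    chain   : ∀ n → s n ≻ s (suc n)
    -- lim b_n/a_n = r (given b_n/a_n > r): ∀ ε > 0, eventually b_n/a_n - ε < r
    limit   : ∀ ε → 0ℚ ℚ.< ε → ∃[ N ] (∀ n → N ≤ n → Lower r (ratio (s n) - ε))
    divides : ∀ n → proj₁ (s n) ∣ proj₁ (s (suc n))
    cofinalDiv : ∀ m → m ≥ 1 → ∃[ n ] (m ∣ proj₁ (s n))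

module Submission where

-- Given (a , b) ∈ A_r choose a rational q with r < q < b/a and put
-- ε = b/a - q.  Far enough along a good sequence b_n/a_n - ε < r < q, so
-- b_n/a_n < b/a, and a ∣ a_n.  Writing a_n = k·a, the step (a , b) ≻≻ (k·a , k·b)
-- followed by lowering k·b to b_n < k·b gives (a , b) ≻ (a_n , b_n).
--
-- Call (A , B) ∈ A_r tight when (B - 2)/A < r.  Locatedness of the
-- cut r lets us lower the second coordinate of any element of A_r until it is
-- tight.  Start from some (1 , N) ∈ A_r; at step n multiply by n + 2 and then
-- lower to a tight pair.  Every step is a ≻-chain, a_n ∣ a_{n+1}, every m ≥ 2
-- divides a_{m-1}, and a_n ≥ n, so tightness gives b_n/a_n - 2/a_n < r with
-- 2/a_n → 0: the ratios converge to r.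

open import Defs
open import Data.Nat using (ℕ)
open import Data.Product using (_×_; Σ; ∃; ∃-syntax)

open import Data.Nat as ℕ using (zero; suc; _∸_; _≤_; _<_; z≤n; s≤s)
import Data.Nat.Properties as ℕP
open import Data.Nat.Divisibility using (_∣_; divides; ∣-trans; 1∣_; n∣m*n; m∣m*n)
open import Data.Integer as ℤ using (+_; -[1+_])
import Data.Integer.Properties as ℤP
open import Data.Integer.Tactic.RingSolver using (solve-∀)
open import Data.Rational as ℚ using (mkℚ; _/_; 0ℚ; toℚᵘ; ↧ₙ_)
import Data.Rational.Properties as ℚP
open import Data.Rational.Solver using (module +-*-Solver)
open import Data.Rational.Unnormalised as ℚᵘ using (mkℚᵘ; *<*; *≡*)
import Data.Rational.Unnormalised.Properties as ℚᵘP
open import Data.Product using (_,_; proj₁; proj₂)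
open import Data.Sum using ([_,_]′)
open import Data.Empty using (⊥-elim)
open import Function using (_∘_)
open import Relation.Binary.Definitions using (tri<; tri≈; tri>)
open import Relation.Binary.Construct.Closure.ReflexiveTransitive as Star using (_◅_; _◅◅_)
open import Relation.Binary.PropositionalEquality

toℚᵘ-/ : ∀ i a → toℚᵘ (i / suc a) ℚᵘ.≃ mkℚᵘ i a
toℚᵘ-/ i a = ℚP.toℚᵘ-fromℚᵘ (mkℚᵘ i a)

/-<-cross : ∀ i j a b → i ℤ.* + suc b ℤ.< j ℤ.* + suc a → i / suc a ℚ.< j / suc b
/-<-cross i j a b h = ℚP.toℚᵘ-cancel-<
  (ℚᵘP.<-respˡ-≃ (ℚᵘP.≃-sym (toℚᵘ-/ i a)) (ℚᵘP.<-respʳ-≃ (ℚᵘP.≃-sym (toℚᵘ-/ j b)) (*<* h)))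

/-<-cross⁻ : ∀ i j a b → i / suc a ℚ.< j / suc b → i ℤ.* + suc b ℤ.< j ℤ.* + suc a
/-<-cross⁻ i j a b h = ℚᵘP.drop-*<*
  (ℚᵘP.<-respˡ-≃ (toℚᵘ-/ i a) (ℚᵘP.<-respʳ-≃ (toℚᵘ-/ j b) (ℚP.toℚᵘ-mono-< h)))

/-≡-cross : ∀ i j a b → i ℤ.* + suc b ≡ j ℤ.* + suc a → i / suc a ≡ j / suc b
/-≡-cross i j a b h = ℚP.toℚᵘ-injective
  (ℚᵘP.≃-trans (toℚᵘ-/ i a) (ℚᵘP.≃-trans (*≡* h) (ℚᵘP.≃-sym (toℚᵘ-/ j b))))

/-distrib-+ : ∀ i j a → (i ℤ.+ j) / suc a ≡ i / suc a ℚ.+ j / suc a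
/-distrib-+ i j a = ℚP.toℚᵘ-injective (ℚᵘP.≃-trans (toℚᵘ-/ (i ℤ.+ j) a) (ℚᵘP.≃-sym sum≃))
  where
  A = + suc a
  cross : ∀ i j A → (i ℤ.+ j) ℤ.* (A ℤ.* A) ≡ (i ℤ.* A ℤ.+ j ℤ.* A) ℤ.* A
  cross = solve-∀
  sum≃ : toℚᵘ (i / suc a ℚ.+ j / suc a) ℚᵘ.≃ mkℚᵘ (i ℤ.+ j) a
  sum≃ = ℚᵘP.≃-trans (ℚP.toℚᵘ-homo-+ (i / suc a) (j / suc a))
           (ℚᵘP.≃-trans (ℚᵘP.+-cong (toℚᵘ-/ i a) (toℚᵘ-/ j a)) (*≡* (sym (cross i j A))))

ratio-< : ∀ {a b a' b'} → b ℕ.* suc a' < b' ℕ.* suc a → ratio (suc a , b) ℚ.< ratio (suc a' , b')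
ratio-< {a} {b} {a'} {b'} h = /-<-cross (+ b) (+ b') a a'
  (subst₂ ℤ._<_ (ℤP.pos-* b (suc a')) (ℤP.pos-* b' (suc a)) (ℤ.+<+ h))

ratio-<⁻ : ∀ {a b a' b'} → ratio (suc a , b) ℚ.< ratio (suc a' , b') → b ℕ.* suc a' < b' ℕ.* suc a
ratio-<⁻ {a} {b} {a'} {b'} h = ℤP.drop‿+<+
  (subst₂ ℤ._<_ (sym (ℤP.pos-* b (suc a'))) (sym (ℤP.pos-* b' (suc a))) (/-<-cross⁻ (+ b) (+ b') a a' h))

ratio-scale : ∀ k a b → ratio (suc a , b) ≡ ratio (suc k ℕ.* suc a , suc k ℕ.* b)
ratio-scale k a b = /-≡-cross (+ b) (+ (suc k ℕ.* b)) a (a ℕ.+ k ℕ.* suc a)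
  (trans (sym (ℤP.pos-* b (suc k ℕ.* suc a))) (trans (cong +_ bkA≡kbA) (ℤP.pos-* (suc k ℕ.* b) (suc a))))
  where
  open ≡-Reasoning
  bkA≡kbA : b ℕ.* (suc k ℕ.* suc a) ≡ suc k ℕ.* b ℕ.* suc a
  bkA≡kbA = begin
    b ℕ.* (suc k ℕ.* suc a) ≡⟨ ℕP.*-assoc b (suc k) (suc a) ⟨
    b ℕ.* suc k ℕ.* suc a   ≡⟨ cong (ℕ._* suc a) (ℕP.*-comm b (suc k)) ⟩
    suc k ℕ.* b ℕ.* suc a   ∎

module ℚ-Algebra where
  open +-*-Solver

  sub-add : ∀ y e → y ℚ.- e ℚ.+ e ≡ y
  sub-add = solve 2 (λ y e → y :- e :+ e := y) refl

  add-sub : ∀ q x → q ℚ.+ (x ℚ.- q) ≡ x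
  add-sub = solve 2 (λ q x → q :+ (x :- q) := x) refl

  add-sub-cancel : ∀ c d → c ℚ.+ d ℚ.- d ≡ c
  add-sub-cancel = solve 2 (λ c d → c :+ d :- d := c) refl

open ℚ-Algebra

ratio-drop-two : ∀ a c → ratio (suc a , c) ≡ ratio (suc a , suc (suc c)) ℚ.- ratio (suc a , 2)
ratio-drop-two a c = begin
  + c / suc a                                 ≡⟨ add-sub-cancel _ _ ⟨
  + c / suc a ℚ.+ + 2 / suc a ℚ.- + 2 / suc a ≡⟨ cong (ℚ._- + 2 / suc a) (/-distrib-+ (+ c) (+ 2) a) ⟨
  + (c ℕ.+ 2) / suc a ℚ.- + 2 / suc a         ≡⟨ cong (λ n → + n / suc a ℚ.- + 2 / suc a) (ℕP.+-comm c 2) ⟩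
  + suc (suc c) / suc a ℚ.- + 2 / suc a       ∎
  where open ≡-Reasoning

<⇒0<-gap : ∀ {q x} → q ℚ.< x → 0ℚ ℚ.< x ℚ.- q
<⇒0<-gap {q} {x} q<x = subst (ℚ._< x ℚ.- q) (ℚP.+-inverseʳ q) (ℚP.+-monoˡ-< (ℚ.- q) q<x)

<⇒-<0 : ∀ {x y} → x ℚ.< y → x ℚ.- y ℚ.< 0ℚ
<⇒-<0 {x} {y} x<y = subst (x ℚ.- y ℚ.<_) (ℚP.+-inverseʳ y) (ℚP.+-monoˡ-< (ℚ.- y) x<y)

-‿antimono : ∀ x {δ ε} → δ ℚ.< ε → x ℚ.- ε ℚ.< x ℚ.- δ
-‿antimono x δ<ε = ℚP.+-monoʳ-< x (ℚP.neg-antimono-< δ<ε)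

<-of-gap : ∀ y x q → y ℚ.- (x ℚ.- q) ℚ.< q → y ℚ.< x
<-of-gap y x q h = subst₂ ℚ._<_ (sub-add y (x ℚ.- q)) (add-sub q x) (ℚP.+-monoˡ-< (x ℚ.- q) h)

below-integer : ∀ q → ∃[ N ] (q ℚ.< + suc N / 1)
below-integer q@(mkℚ n d _) =
  ℤ.∣ n ∣ , subst (ℚ._< _) (ℚP.↥p/↧p≡p q) (/-<-cross n (+ suc ℤ.∣ n ∣) d 0 (bound n))
  where
  bound : ∀ n → n ℤ.* + 1 ℤ.< + suc ℤ.∣ n ∣ ℤ.* + suc d
  bound (+ n) = subst₂ ℤ._<_ (ℤP.pos-* n 1) (ℤP.pos-* (suc n) (suc d))
    (ℤ.+<+ (s≤s (ℕP.≤-trans (ℕP.*-monoʳ-≤ n (s≤s z≤n)) (ℕP.m≤n+m (n ℕ.* suc d) d))))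
  bound -[1+ n ] = ℤ.-<+

two-over-small : ∀ ε → 0ℚ ℚ.< ε → ∀ a → 2 ℕ.* ↧ₙ ε ≤ a → ratio (suc a , 2) ℚ.< ε
two-over-small ε@(mkℚ (+ suc e) d _) _ a h =
  subst (ratio (suc a , 2) ℚ.<_) (ℚP.↥p/↧p≡p ε) (ratio-< {a} {2} {d} {suc e} (ℕP.≤-trans (s≤s h) (ℕP.m≤n*m (suc a) (suc e))))
two-over-small (mkℚ (+ zero) _ _) 0<ε _ _ = ⊥-elim (ℤP.<-irrefl refl (ℚP.drop-*<* 0<ε))
two-over-small (mkℚ -[1+ _ ] _ _) 0<ε _ _ with ℚP.drop-*<* 0<ε
... | ()

lower<upper : ∀ (r : PosReal) {x y} → Lower r x → Upper r y → x ℚ.< y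
lower<upper r {x} {y} lx uy with ℚP.<-cmp x y
... | tri< x<y _ _ = x<y
... | tri≈ _ refl _ = ⊥-elim (disjoint r (lx , uy))
... | tri> _ _ y<x = ⊥-elim (disjoint r (lower-round₂ r y<x lx , uy))

≻-lower : ∀ A k d → (A , suc (k ℕ.+ d)) ≻ (A , suc d)
≻-lower A zero    d = Star.ε
≻-lower A (suc k) d = decB ◅ ≻-lower A k d

≻-descend : ∀ A {c d} → 1 ≤ d → d ≤ c → (A , c) ≻ (A , d)
≻-descend A {suc c} {suc d} _ (s≤s d≤c) =
  subst (λ x → (A , suc x) ≻ (A , suc d)) (ℕP.m∸n+n≡m d≤c) (≻-lower A (c ∸ d) d)

≻-below : ∀ a b {a' b'} → suc a ∣ a' → 1 ≤ b' → b' ℕ.* suc a < b ℕ.* a' → (suc a , b) ≻ (a' , b')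
≻-below a b {b' = b'} (divides zero refl) _ h =
  ⊥-elim (ℕP.n≮0 (subst (b' ℕ.* suc a <_) (ℕP.*-zeroʳ b) h))
≻-below a b {b' = b'} (divides k@(suc _) refl) b'≥1 h =
  mulN k (s≤s z≤n) ◅ ≻-descend (k ℕ.* suc a) b'≥1 (ℕP.<⇒≤ b'<kb)
  where
  bkA≡kbA : b ℕ.* (k ℕ.* suc a) ≡ k ℕ.* b ℕ.* suc a
  bkA≡kbA = trans (sym (ℕP.*-assoc b k (suc a))) (cong (ℕ._* suc a) (ℕP.*-comm b k))
  b'<kb : b' < k ℕ.* b
  b'<kb = ℕP.*-cancelʳ-< (suc a) b' (k ℕ.* b) (subst (b' ℕ.* suc a <_) bkA≡kbA h)

module Cofinality (r : PosReal) (s : ℕ → Pair) (good : GoodSeq r s) where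
  open GoodSeq good renaming (divides to aₙ∣aₙ₊₁)

  ∣-later : ∀ {m M} → m ∣ proj₁ (s M) → ∀ k → m ∣ proj₁ (s (k ℕ.+ M))
  ∣-later m∣ zero    = m∣
  ∣-later m∣ (suc k) = ∣-trans (∣-later m∣ k) (aₙ∣aₙ₊₁ (k ℕ.+ _))

  ≻-term : ∀ a b t → InA t → suc a ∣ proj₁ t → ratio t ℚ.< ratio (suc a , b) → (suc a , b) ≻ t
  ≻-term a b (zero  , b') (() , _)
  ≻-term a b (suc a' , b') (_ , b'≥1) a∣ t<p = ≻-below a b a∣ b'≥1 (ratio-<⁻ {a'} {b'} {a} {b} t<p)

  cofinal : ∀ p → InAr r p → ∃[ n ] (p ≻ s n)
  cofinal (zero  , b) ((() , _) , _)
  cofinal (suc a , b) (_ , up) = n , ≻-term a b (s n) (proj₁ (inAr n)) (∣-later a∣ N) sₙ<p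
    where
    x = ratio (suc a , b)
    q = proj₁ (upper-round₁ r up)
    q<x = proj₁ (proj₂ (upper-round₁ r up))
    above-q = proj₂ (proj₂ (upper-round₁ r up))
    close = limit (x ℚ.- q) (<⇒0<-gap q<x)
    N = proj₁ close
    M = proj₁ (cofinalDiv (suc a) (s≤s z≤n))
    a∣ = proj₂ (cofinalDiv (suc a) (s≤s z≤n))
    n = N ℕ.+ M
    sₙ<p : ratio (s n) ℚ.< x
    sₙ<p = <-of-gap (ratio (s n)) x q (lower<upper r (proj₂ close n (ℕP.m≤m+n N M)) above-q)

module Construction (r : PosReal) where

  Tight : ℕ → ℕ → Set
  Tight a b = Lower r (ratio (suc a , b) ℚ.- ratio (suc a , 2))

  tight-close : ∀ {a b} ε → 0ℚ ℚ.< ε → 2 ℕ.* ↧ₙ ε ≤ a → Tight a b → Lower r (ratio (suc a , b) ℚ.- ε)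
  tight-close {a} {b} ε 0<ε h =
    lower-round₂ r (-‿antimono (ratio (suc a , b)) (two-over-small ε 0<ε a h))

  tight-at-1 : ∀ a → Tight a 1
  tight-at-1 a = lower-round₂ r (<⇒-<0 (ratio-< {a} {1} {a} {2} (ℕP.*-monoˡ-< (suc a) (ℕP.n<1+n 1)))) (positive r)

  record Lowering (a b : ℕ) : Set where
    field
      b'    : ℕ
      b'≥1  : 1 ≤ b'
      b'≤b  : b' ≤ b
      upper : Upper r (ratio (suc a , b'))
      tight : Tight a b'

  lowering-suc : ∀ {a b} → Lowering a b → Lowering a (suc b)
  lowering-suc l = record { Lowering l ; b'≤b = ℕP.m≤n⇒m≤1+n (Lowering.b'≤b l) }

  -- Every element of A_r can be lowered to a tight one.  For b = c + 2, locatedness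
  -- at c/(a+1) < (c+1)/(a+1) either makes b itself tight or keeps b - 1 inside A_r.
  lower : ∀ a b → 1 ≤ b → Upper r (ratio (suc a , b)) → Lowering a b
  lower a (suc zero) b≥1 up = record { b'≥1 = b≥1 ; b'≤b = ℕP.≤-refl ; upper = up ; tight = tight-at-1 a }
  lower a (suc (suc c)) b≥1 up =
    [ c-lower⇒tight , (λ c+1-upper → lowering-suc (lower a (suc c) (s≤s z≤n) c+1-upper)) ]′
    (located r (ratio-< {a} {c} {a} {suc c} (ℕP.*-monoˡ-< (suc a) (ℕP.n<1+n c))))
    where
    c-lower⇒tight : Lower r (ratio (suc a , c)) → Lowering a (suc (suc c))
    c-lower⇒tight c-lower = record
      { b'≥1 = b≥1 ; b'≤b = ℕP.≤-refl ; upper = up ; tight = subst (Lower r) (ratio-drop-two a c) c-lower }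

  record Point : Set where
    constructor point
    field
      a b   : ℕ
      b≥1   : 1 ≤ b
      upper : Upper r (ratio (suc a , b))
  open Point

  pair : Point → Pair
  pair p = suc (a p) , b p

  scale : ℕ → Point → Point
  scale k p = point (a p ℕ.+ k ℕ.* suc (a p)) (suc k ℕ.* b p)
    (ℕP.≤-trans (b≥1 p) (ℕP.m≤n*m (b p) (suc k)))
    (subst (Upper r) (ratio-scale k (a p) (b p)) (upper p))

  scale-≻ : ∀ k p → pair p ≻ pair (scale k p)
  scale-≻ k p = mulN (suc k) (s≤s z≤n) ◅ Star.ε

  lowering : (p : Point) → Lowering (a p) (b p)
  lowering p = lower (a p) (b p) (b≥1 p) (upper p)

  tighten : Point → Point
  tighten p = point (a p) (Lowering.b' l) (Lowering.b'≥1 l) (Lowering.upper l)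
    where l = lowering p

  tighten-≻ : ∀ p → pair p ≻ pair (tighten p)
  tighten-≻ p = ≻-descend (suc (a p)) (Lowering.b'≥1 (lowering p)) (Lowering.b'≤b (lowering p))

  tighten-tight : ∀ p → Tight (a (tighten p)) (b (tighten p))
  tighten-tight p = Lowering.tight (lowering p)

  step : ℕ → Point → Point
  step n = tighten ∘ scale (suc n)

  step-≻ : ∀ n p → pair p ≻ pair (step n p)
  step-≻ n p = scale-≻ (suc n) p ◅◅ tighten-≻ (scale (suc n) p)

  step-grows : ∀ n p → suc n ≤ a (step n p)
  step-grows n p = ℕP.≤-trans (ℕP.m≤m*n (suc n) (suc (a p))) (ℕP.m≤n+m (suc n ℕ.* suc (a p)) (a p))

  start : Point
  start = point 0 (suc N) (s≤s z≤n) (upper-round₂ r q<N (proj₂ (upper-inhab r)))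
    where
    N = proj₁ (below-integer (proj₁ (upper-inhab r)))
    q<N = proj₂ (below-integer (proj₁ (upper-inhab r)))

  points : ℕ → Point
  points zero    = start
  points (suc n) = step n (points n)

  sequence : ℕ → Pair
  sequence = pair ∘ points

  good : GoodSeq r sequence
  good = record
    { inAr       = λ n → (s≤s z≤n , b≥1 (points n)) , upper (points n)
    ; chain      = λ n → step-≻ n (points n)
    ; limit      = converges
    ; divides    = λ n → n∣m*n (suc (suc n))
    ; cofinalDiv = every-divisor
    }
    where
    converges : ∀ ε → 0ℚ ℚ.< ε → ∃[ N ] (∀ n → N ≤ n → Lower r (ratio (sequence n) ℚ.- ε))
    converges ε 0<ε = suc (2 ℕ.* ↧ₙ ε) , λ where
      (suc n) (s≤s N≤n) → tight-close {b = b (points (suc n))} ε 0<ε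
        (ℕP.≤-trans N≤n (ℕP.≤-trans (ℕP.n≤1+n n) (step-grows n (points n))))
        (tighten-tight (scale (suc n) (points n)))
    every-divisor : ∀ m → 1 ≤ m → ∃[ n ] (m ∣ proj₁ (sequence n))
    every-divisor (suc zero)    _ = zero , 1∣ _
    every-divisor (suc (suc m)) _ = suc m , m∣m*n (suc (a (points m)))

lemma1p15 : (r : PosReal)
    → (∃[ s ] GoodSeq r s)
    × (∀ (s : ℕ → Pair) → GoodSeq r s → ∀ p → InAr r p → ∃[ n ] (p ≻ s n))
lemma1p15 r = (Construction.sequence r , Construction.good r) , Cofinality.cofinal r
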